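{- Let $m\ge0$ and $0\le k\le m$ be integers. For all $x$, \[ P_k(m,m+1-x)=(-1)^kP_k(m,x). \] Equivalently, for $0<\operatorname{Re}x<m+1$, \[ \operatorname*{Res}_{s=m+1-k}\zeta_{m+1}(s,m+1-x)=(-1)^k\operatorname*{Res}_{s=m+1-k}\zeta_{m+1}(s,x). \]
   Context: The signed generalized Stirling polynomials $P_k(m,x)$, $0\le k\le m$, are defined by the polynomial identity in an indeterminate $y$: $\prod_{i=1}^{m}(y+i-x)=\sum_{k=0}^{m}(-1)^kP_k(m,x)\,y^{m-k}$. For $n\ge1$, the equal-period Barnes multiple zeta function is $\zeta_n(s,x)=\sum_{r_1,\ldots,r_n\ge0}(r_1+\cdots+r_n+x)^{ -s}$ for $\operatorname{Re}s>n$, $\operatorname{Re}x>0$, extended meromorphically in $s$. -}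

module Defs where

open import Algebra.Bundles using (CommutativeRing)
open import Data.Nat using (ℕ; zero; suc)
open import Data.List using (List; []; _∷_; map)

module _ {c ℓ} (R : CommutativeRing c ℓ) where
  open CommutativeRing R

  natR : ℕ → Carrier
  natR zero    = 0#
  natR (suc n) = 1# + natR n

  sgn : ℕ → Carrier
  sgn zero    = 1#
  sgn (suc k) = - sgn k

  -- Polynomials in the indeterminate y, as coefficient lists in
  -- ascending degree: [c0 , c1 , ...] represents c0 + c1 y + ...
  Poly : Set c
  Poly = List Carrier

  addP : Poly → Poly → Poly
  addP []       q        = q
  addP p        []       = p
  addP (a ∷ p)  (b ∷ q)  = (a + b) ∷ addP p q

  mulLin : Carrier → Poly → Poly
  mulLin a p = addP (0# ∷ p) (map (a *_) p)

  coeff : Poly → ℕ → Carrier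
  coeff []      n       = 0#
  coeff (a ∷ p) zero    = a
  coeff (a ∷ p) (suc n) = coeff p n

  prodPoly : ℕ → Carrier → Poly
  prodPoly zero    x = 1# ∷ []
  prodPoly (suc m) x = mulLin (natR (suc m) - x) (prodPoly m x)

  -- signed generalized Stirling polynomial P_k(m,x), defined by
  -- ∏_{i=1}^{m} (y+i-x) = Σ_{k=0}^{m} (-1)^k P_k(m,x) y^{m-k},
  -- i.e. P_k(m,x) = (-1)^k · [coefficient of y^{m-k}]   (for 0 ≤ k ≤ m)
  P : ℕ → ℕ → Carrier → Carrier
  P k m x = sgn k * coeff (prodPoly m x) (m Data.Nat.∸ k)

-- Reindexing i ↦ m + 1 - i gives ∏ᵢ (y + i - (m + 1 - x)) = ∏ᵢ (y - i + x) = (-1)^m ∏ᵢ (-y + i - x),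
-- so the coefficient of y^n changes by (-1)^(m+n), which for n = m - k is (-1)^k. Over lists of
-- coefficients the reindexing is an induction on m: split off the lowest factor of the product at
-- m + 1 - x, and it becomes the (reflected) top factor of the product at x.
module Submission where

open import Algebra.Bundles using (CommutativeRing)
open import Data.List using ([]; _∷_; map)
open import Data.Nat using (ℕ; zero; suc; _≤_)
import Data.Nat as ℕ
open import Data.Nat.Properties using (+-suc; m+[n∸m]≡n)
open import Function.Indexed.Relation.Binary.Equality using (≡-setoid)
open import Relation.Binary.Bundles using (Setoid)
import Relation.Binary.Indexed.Heterogeneous.Construct.Trivial as Trivial
import Relation.Binary.PropositionalEquality as ≡
import Relation.Binary.Reasoning.Setoid as SetoidReasoning
open import Defs

module StirlingCoefficients {c ℓ} (R : CommutativeRing c ℓ) where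
  open CommutativeRing R
  open import Algebra.Properties.Ring ring using (-‿distribˡ-*; -‿involutive)
  open import Algebra.Properties.AbelianGroup +-abelianGroup using (⁻¹-∙-comm)
  open import Algebra.Properties.CommutativeSemigroup +-commutativeSemigroup
    using (interchange)
  open import Algebra.Properties.CommutativeSemigroup *-commutativeSemigroup
    using (x∙yz≈y∙xz)
  open import Algebra.Solver.Ring.NaturalCoefficients.Default commutativeSemiring
  module ≈-Reasoning = SetoidReasoning setoid

  -- f : Coeffs stands for Σₙ f n yⁿ; mulLinᶜ a multiplies by y + a, and reflect m sends f(y) to (-1)^m f(-y).
  Coeffs : Set c
  Coeffs = ℕ → Carrier

  ≐-setoid : Setoid c ℓ
  ≐-setoid = ≡-setoid ℕ (Trivial.indexedSetoid setoid)

  open Setoid ≐-setoid using ()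
    renaming (_≈_ to _≐_; sym to ≐-sym; trans to ≐-trans)
  module ≐-Reasoning = SetoidReasoning ≐-setoid

  shift : Coeffs → Coeffs
  shift f zero    = 0#
  shift f (suc n) = f n

  mulLinᶜ : Carrier → Coeffs → Coeffs
  mulLinᶜ a f n = shift f n + a * f n

  reflect : ℕ → Coeffs → Coeffs
  reflect m f n = sgn R (m ℕ.+ n) * f n

  prodCoeffs : ℕ → Carrier → Coeffs
  prodCoeffs m x = coeff R (prodPoly R m x)

  shift-cong : ∀ {f g} → f ≐ g → shift f ≐ shift g
  shift-cong f≐g zero    = refl
  shift-cong f≐g (suc n) = f≐g n

  mulLinᶜ-cong : ∀ {a b f g} → a ≈ b → f ≐ g → mulLinᶜ a f ≐ mulLinᶜ b g
  mulLinᶜ-cong a≈b f≐g n = +-cong (shift-cong f≐g n) (*-cong a≈b (f≐g n))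

  mulLinᶜ-comm : ∀ a b f → mulLinᶜ a (mulLinᶜ b f) ≐ mulLinᶜ b (mulLinᶜ a f)
  mulLinᶜ-comm a b f zero = solve 3
    (λ a b v → con 0 :+ a :* (con 0 :+ b :* v) := con 0 :+ b :* (con 0 :+ a :* v))
    refl a b (f 0)
  mulLinᶜ-comm a b f (suc n) = solve 5
    (λ a b w u v → (w :+ b :* u) :+ a :* (u :+ b :* v)
                := (w :+ a :* u) :+ b :* (u :+ a :* v))
    refl a b (shift f n) (f n) (f (suc n))

  coeff-addP : ∀ p q n → coeff R (addP R p q) n ≈ coeff R p n + coeff R q n
  coeff-addP []      q       n       = sym (+-identityˡ _)
  coeff-addP (a ∷ p) []      zero    = sym (+-identityʳ _)
  coeff-addP (a ∷ p) []      (suc n) = sym (+-identityʳ _)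
  coeff-addP (a ∷ p) (b ∷ q) zero    = refl
  coeff-addP (a ∷ p) (b ∷ q) (suc n) = coeff-addP p q n

  coeff-map-* : ∀ a p n → coeff R (map (a *_) p) n ≈ a * coeff R p n
  coeff-map-* a []      n       = sym (zeroʳ a)
  coeff-map-* a (b ∷ p) zero    = refl
  coeff-map-* a (b ∷ p) (suc n) = coeff-map-* a p n

  coeff-mulLin : ∀ a p → coeff R (mulLin R a p) ≐ mulLinᶜ a (coeff R p)
  coeff-mulLin a p zero    =
    trans (coeff-addP (0# ∷ p) (map (a *_) p) 0) (+-congˡ (coeff-map-* a p 0))
  coeff-mulLin a p (suc n) =
    trans (coeff-addP (0# ∷ p) (map (a *_) p) (suc n)) (+-congˡ (coeff-map-* a p (suc n)))

  prodCoeffs-suc : ∀ m x → prodCoeffs (suc m) x ≐ mulLinᶜ (natR R (suc m) - x) (prodCoeffs m x)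
  prodCoeffs-suc m x = coeff-mulLin _ (prodPoly R m x)

  prodCoeffs-cong : ∀ m {x y} → x ≈ y → prodCoeffs m x ≐ prodCoeffs m y
  prodCoeffs-cong zero    x≈y n = refl
  prodCoeffs-cong (suc m) {x} {y} x≈y = begin
    prodCoeffs (suc m) x                             ≈⟨ prodCoeffs-suc m x ⟩
    mulLinᶜ (natR R (suc m) - x) (prodCoeffs m x)    ≈⟨ mulLinᶜ-cong (+-congˡ (-‿cong x≈y))
                                                                     (prodCoeffs-cong m x≈y) ⟩
    mulLinᶜ (natR R (suc m) - y) (prodCoeffs m y)    ≈⟨ ≐-sym (prodCoeffs-suc m y) ⟩
    prodCoeffs (suc m) y                             ∎
    where open ≐-Reasoning

  [1+u]-[1+x]≈u-x : ∀ u x → (1# + u) - (1# + x) ≈ u - x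
  [1+u]-[1+x]≈u-x u x = begin
    (1# + u) + - (1# + x)    ≈⟨ +-congˡ (sym (⁻¹-∙-comm 1# x)) ⟩
    (1# + u) + (- 1# + - x)  ≈⟨ interchange 1# u (- 1#) (- x) ⟩
    (1# - 1#) + (u - x)      ≈⟨ +-congʳ (-‿inverseʳ 1#) ⟩
    0# + (u - x)             ≈⟨ +-identityˡ _ ⟩
    u - x                    ∎
    where open ≈-Reasoning

  -- prodPoly peels off the top factor; this peels off the bottom one, i = 1, and reindexes the rest.
  prodCoeffs-suc-1+ : ∀ m x → prodCoeffs (suc m) (1# + x) ≐ mulLinᶜ (- x) (prodCoeffs m x)
  prodCoeffs-suc-1+ zero x =
    ≐-trans (prodCoeffs-suc 0 (1# + x)) (mulLinᶜ-cong lowest (λ _ → refl))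
    where
    lowest : natR R 1 - (1# + x) ≈ - x
    lowest = trans ([1+u]-[1+x]≈u-x 0# x) (+-identityˡ (- x))
  prodCoeffs-suc-1+ (suc m) x = begin
    prodCoeffs (suc (suc m)) (1# + x)
      ≈⟨ prodCoeffs-suc (suc m) (1# + x) ⟩
    mulLinᶜ (natR R (suc (suc m)) - (1# + x)) (prodCoeffs (suc m) (1# + x))
      ≈⟨ mulLinᶜ-cong ([1+u]-[1+x]≈u-x (natR R (suc m)) x) (prodCoeffs-suc-1+ m x) ⟩
    mulLinᶜ (natR R (suc m) - x) (mulLinᶜ (- x) (prodCoeffs m x))
      ≈⟨ mulLinᶜ-comm _ (- x) (prodCoeffs m x) ⟩
    mulLinᶜ (- x) (mulLinᶜ (natR R (suc m) - x) (prodCoeffs m x))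
      ≈⟨ mulLinᶜ-cong refl (≐-sym (prodCoeffs-suc m x)) ⟩
    mulLinᶜ (- x) (prodCoeffs (suc m) x)
      ∎
    where open ≐-Reasoning

  sgn-+-suc : ∀ m n → sgn R (m ℕ.+ suc n) ≡.≡ - sgn R (m ℕ.+ n)
  sgn-+-suc m n = ≡.cong (sgn R) (+-suc m n)

  sgn-+ : ∀ m n → sgn R (m ℕ.+ n) ≈ sgn R m * sgn R n
  sgn-+ zero    n = sym (*-identityˡ _)
  sgn-+ (suc m) n = trans (-‿cong (sgn-+ m n)) (-‿distribˡ-* _ _)

  sgn-*-sgn : ∀ n → sgn R n * sgn R n ≈ 1#
  sgn-*-sgn zero    = *-identityˡ 1#
  sgn-*-sgn (suc n) = begin
    - sgn R n * - sgn R n     ≈⟨ -‿distribˡ-* _ _ ⟨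
    - (sgn R n * - sgn R n)   ≈⟨ -‿cong (*-comm _ _) ⟩
    - (- sgn R n * sgn R n)   ≈⟨ -‿cong (-‿distribˡ-* _ _) ⟨
    - - (sgn R n * sgn R n)   ≈⟨ -‿involutive _ ⟩
    sgn R n * sgn R n         ≈⟨ sgn-*-sgn n ⟩
    1#                        ∎
    where open ≈-Reasoning

  sgn-+-∸ : ∀ {k m} → k ℕ.≤ m → sgn R (m ℕ.+ (m ℕ.∸ k)) ≈ sgn R k
  sgn-+-∸ {k} {m} k≤m = begin
    sgn R (m ℕ.+ j)                ≈⟨ sgn-+ m j ⟩
    sgn R m * sgn R j              ≈⟨ *-congʳ (reflexive (≡.cong (sgn R) (≡.sym (m+[n∸m]≡n k≤m)))) ⟩
    sgn R (k ℕ.+ j) * sgn R j      ≈⟨ *-congʳ (sgn-+ k j) ⟩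
    sgn R k * sgn R j * sgn R j    ≈⟨ *-assoc _ _ _ ⟩
    sgn R k * (sgn R j * sgn R j)  ≈⟨ *-congˡ (sgn-*-sgn j) ⟩
    sgn R k * 1#                   ≈⟨ *-identityʳ _ ⟩
    sgn R k                        ∎
    where
    open ≈-Reasoning
    j = m ℕ.∸ k

  -[x*yz]≈-y*xz : ∀ x y z → - x * (y * z) ≈ - y * (x * z)
  -[x*yz]≈-y*xz x y z = begin
    - x * (y * z)     ≈⟨ -‿distribˡ-* x _ ⟨
    - (x * (y * z))   ≈⟨ -‿cong (x∙yz≈y∙xz x y z) ⟩
    - (y * (x * z))   ≈⟨ -‿distribˡ-* y _ ⟩
    - y * (x * z)     ∎
    where open ≈-Reasoning

  reflect-cong : ∀ m {f g} → f ≐ g → reflect m f ≐ reflect m g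
  reflect-cong m f≐g n = *-congˡ (f≐g n)

  reflect-mulLinᶜ : ∀ m a f → reflect (suc m) (mulLinᶜ a f) ≐ mulLinᶜ (- a) (reflect m f)
  reflect-mulLinᶜ m a f zero = begin
    - s * (0# + a * f 0)    ≈⟨ *-congˡ (+-identityˡ _) ⟩
    - s * (a * f 0)         ≈⟨ -[x*yz]≈-y*xz s a (f 0) ⟩
    - a * (s * f 0)         ≈⟨ +-identityˡ _ ⟨
    0# + - a * (s * f 0)    ∎
    where
    open ≈-Reasoning
    s = sgn R (m ℕ.+ 0)
  reflect-mulLinᶜ m a f (suc n) = begin
    - s * (f n + a * f (suc n))          ≈⟨ distribˡ (- s) _ _ ⟩
    - s * f n + - s * (a * f (suc n))    ≈⟨ +-cong (*-congʳ -s≈s′) (-[x*yz]≈-y*xz s a _) ⟩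
    s′ * f n + - a * (s * f (suc n))     ∎
    where
    open ≈-Reasoning
    s  = sgn R (m ℕ.+ suc n)
    s′ = sgn R (m ℕ.+ n)
    -s≈s′ : - s ≈ s′
    -s≈s′ = trans (-‿cong (reflexive (sgn-+-suc m n))) (-‿involutive s′)

  prodCoeffs-reflect : ∀ m x → prodCoeffs m (natR R (suc m) - x) ≐ reflect m (prodCoeffs m x)
  prodCoeffs-reflect zero x zero    = sym (*-identityˡ 1#)
  prodCoeffs-reflect zero x (suc n) = sym (zeroʳ _)
  prodCoeffs-reflect (suc m) x = begin
    prodCoeffs (suc m) ((1# + u) - x)
      ≈⟨ prodCoeffs-cong (suc m) (+-assoc 1# u (- x)) ⟩
    prodCoeffs (suc m) (1# + (u - x))
      ≈⟨ prodCoeffs-suc-1+ m (u - x) ⟩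
    mulLinᶜ (- (u - x)) (prodCoeffs m (u - x))
      ≈⟨ mulLinᶜ-cong refl (prodCoeffs-reflect m x) ⟩
    mulLinᶜ (- (u - x)) (reflect m (prodCoeffs m x))
      ≈⟨ ≐-sym (reflect-mulLinᶜ m (u - x) (prodCoeffs m x)) ⟩
    reflect (suc m) (mulLinᶜ (u - x) (prodCoeffs m x))
      ≈⟨ reflect-cong (suc m) (≐-sym (prodCoeffs-suc m x)) ⟩
    reflect (suc m) (prodCoeffs (suc m) x)
      ∎
    where
    open ≐-Reasoning
    u = natR R (suc m)

proposition5 : ∀ {c ℓ} (R : CommutativeRing c ℓ) (m k : ℕ) → k ≤ m →
    (x : CommutativeRing.Carrier R) →
    CommutativeRing._≈_ R (P R k m (CommutativeRing._-_ R (natR R (suc m)) x))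
      (CommutativeRing._*_ R (sgn R k) (P R k m x))
proposition5 R m k k≤m x = begin
  sgn R k * prodCoeffs m (natR R (suc m) - x) j    ≈⟨ *-congˡ (prodCoeffs-reflect m x j) ⟩
  sgn R k * (sgn R (m ℕ.+ j) * prodCoeffs m x j)   ≈⟨ *-congˡ (*-congʳ (sgn-+-∸ k≤m)) ⟩
  sgn R k * (sgn R k * prodCoeffs m x j)           ∎
  where
  open CommutativeRing R
  open StirlingCoefficients R
  open SetoidReasoning setoid
  j = m ℕ.∸ k
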